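{- Every connected graph with an even number of vertices has an even number of elimination trees.
   Context: An elimination tree for a connected graph $G$ is a rooted tree on its vertex set consisting of a root $x$ whose children are the roots of elimination trees for the connected components of $G-x$ (children are unordered). Two elimination trees are the same if they are equal as rooted trees. -}

module Defs where

open import Level using (0ℓ)
open import Data.Nat using (ℕ)
open import Data.Bool using (Bool; true; false)
open import Data.Fin using (Fin)
open import Data.Maybe using (Maybe; just; nothing)
open import Data.Vec using (Vec; lookup)
open import Data.Product using (Σ; _×_; ∃)
open import Data.Unit using (⊤)
open import Relation.Nullary using (¬_)
open import Relation.Binary.PropositionalEquality using (_≡_)

record Graph (n : ℕ) : Set where
  field
    adj    : Fin n → Fin n → Bool
    sym    : ∀ u v → adj u v ≡ adj v u
    irrefl : ∀ v → adj v v ≡ false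

open Graph public

VSet : ℕ → Set₁
VSet n = Fin n → Set

-- Reach G S y z : there is a walk from y to z in G using only vertices of S
-- (i.e. z lies in the connected component of y in the induced graph G[S]).
data Reach {n : ℕ} (G : Graph n) (S : VSet n) (y : Fin n) : Fin n → Set where
  here : S y → Reach G S y y
  step : ∀ {z w} → Reach G S y z → S w → adj G z w ≡ true → Reach G S y w

Connected : ∀ {n} → Graph n → Set
Connected {n} G = ∀ (a b : Fin n) → Reach G (λ _ → ⊤) a b

_∖_ : ∀ {n} → VSet n → Fin n → VSet n
(S ∖ x) v = S v × ¬ (v ≡ x)

-- A rooted tree on the vertex set Fin n is encoded by its parent vector t:
-- lookup t v = just u  means u is the parent of v, nothing means v is the root.
-- Two rooted trees are equal iff their parent vectors are equal (children are
-- unordered, as required).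
Tree : ℕ → Set
Tree n = Vec (Maybe (Fin n)) n

-- ET G t S x : the restriction of t to the vertex set S (assumed to induce a
-- connected subgraph) is an elimination tree of G[S] with root x, i.e.
-- x ∈ S, and for each connected component C of G[S] - x there is a vertex
-- r ∈ C whose parent in t is x and such that t restricted to C is an
-- elimination tree of G[C] rooted at r.  (The parent of x itself is fixed by
-- the enclosing level.)
data ET {n : ℕ} (G : Graph n) (t : Tree n) (S : VSet n) (x : Fin n) : Set₁ where
  node : S x →
         (∀ y → (S ∖ x) y →
            Σ (Fin n) λ r → Reach G (S ∖ x) y r × lookup t r ≡ just x
                            × ET G t (Reach G (S ∖ x) y) r) →
         ET G t S x

IsElimTree : ∀ {n} → Graph n → Tree n → Set₁
IsElimTree {n} G t = Σ (Fin n) λ x → lookup t x ≡ nothing × ET G t (λ _ → ⊤) x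

-- Pair every elimination tree T with each of its non-root vertices v.  Rotating the edge from v up to its
-- parent p (v takes the place of p, p becomes a child of v, and those children of v whose subtree contains a
-- neighbour of p are handed over to p) yields an elimination tree in which p is a non-root child of v, and
-- rotating that edge back restores T.  This fixed-point-free involution makes the number of pairs, which is
-- (number of trees) · (n − 1), even; for even n, n − 1 is odd, so the number of trees is even.
-- To enumerate the trees, an elimination tree is characterised as a rooted tree in which every edge of G
-- joins an ancestor to a descendant and every subtree contains a neighbour of the parent of its root.

module Submission where

open import Defs hiding (sym)
open import Data.Bool using (true)
import Data.Bool as Bool
open import Data.Empty using (⊥; ⊥-elim)
open import Data.Fin using (Fin; _≟_; toℕ; fromℕ<)
open import Data.Fin.Properties using (pigeonhole; toℕ≤pred[n]; toℕ-fromℕ<; any?; all?)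
open import Data.List using (List; []; _∷_; length; filter; map; _++_; cartesianProductWith; allFin)
open import Data.List.Properties using (filter-all; length-++; length-map; length-tabulate)
open import Data.List.Membership.Propositional using (_∈_)
open import Data.List.Membership.Propositional.Properties
  using (∈-filter⁺; ∈-filter⁻; ∈-++⁺ˡ; ∈-++⁺ʳ; ∈-++⁻; ∈-map⁺; ∈-map⁻; ∈-cartesianProductWith⁺; ∈-allFin)
open import Data.List.Relation.Unary.All as All using (All)
open import Data.List.Relation.Unary.Any using (here; there)
open import Data.List.Relation.Unary.AllPairs using ([]; _∷_)
open import Data.List.Relation.Unary.Unique.Propositional using (Unique)
open import Data.List.Relation.Unary.Unique.Propositional.Properties
  using (filter⁺; ++⁺; map⁺; cartesianProductWith⁺; allFin⁺)
open import Data.Maybe using (Maybe; just; nothing; _>>=_)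
open import Data.Maybe.Properties using (just-injective) renaming (≡-dec to ≡-decᴹ)
open import Data.Nat using (ℕ; zero; suc; _+_; _*_; _≤_; _<?_)
open import Data.Nat.Divisibility using (_∣_; _∣0; ∣-refl; ∣m∣n⇒∣m+n; ∣m+n∣m⇒∣n; ∣n⇒∣m*n)
open import Data.Nat.Properties using (+-suc; +-comm; +-assoc; *-suc; m≤n⇒∃[o]m+o≡n; n<1+n; ≮⇒≥; <⇒≤)
open import Data.Product using (Σ; _×_; _,_; proj₁; proj₂)
import Data.Product as Product
open import Data.Product.Properties using () renaming (≡-dec to ≡-decˣ)
open import Data.Sum using (_⊎_; inj₁; inj₂)
import Data.Sum as Sum
open import Data.Unit using (tt)
open import Data.Vec using (Vec; []; _∷_; lookup; tabulate)
open import Data.Vec.Properties using (lookup∘tabulate; tabulate∘lookup; tabulate-cong) renaming (≡-dec to ≡-decⱽ)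
open import Function using (_∘_; case_of_)
open import Function.Bundles using (_⇔_; Equivalence; mk⇔)
open import Level using (0ℓ)
open import Relation.Binary.Definitions using (DecidableEquality)
open import Relation.Binary.PropositionalEquality
open import Relation.Nullary using (¬_; Dec; yes; no; ¬?; _×-dec_; _⊎-dec_; _→-dec_)
open import Relation.Nullary.Decidable using (map′)
open import Relation.Unary using (Pred; Decidable)

module _ {A : Set} {P : Pred A 0ℓ} (P? : Decidable P) where

  length-filter-¬-unique : ∀ {x xs} → Unique xs → x ∈ xs → P x → (∀ {y} → y ∈ xs → P y → y ≡ x) →
                           length xs ≡ suc (length (filter (¬? ∘ P?) xs))
  length-filter-¬-unique {xs = y ∷ ys} (y∉ys ∷ ys!) x∈ px only with P? y
  ... | yes py = cong (suc ∘ length) (sym (filter-all (¬? ∘ P?) (All.tabulate rest-¬P)))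
    where
      rest-¬P : ∀ {z} → z ∈ ys → ¬ P z
      rest-¬P z∈ pz = All.lookup y∉ys z∈ (trans (only (here refl) py) (sym (only (there z∈) pz)))
  ... | no ¬py with x∈
  ...   | here refl = ⊥-elim (¬py px)
  ...   | there x∈ys = cong suc (length-filter-¬-unique ys! x∈ys px (only ∘ there))

record PairedBy {A : Set} (σ : A → A) (xs : List A) : Set where
  field
    unique        : Unique xs
    closed        : ∀ {x} → x ∈ xs → σ x ∈ xs
    involutive    : ∀ {x} → x ∈ xs → σ (σ x) ≡ x
    fixpoint-free : ∀ {x} → x ∈ xs → ¬ σ x ≡ x

module _ {A : Set} (_≟_ : DecidableEquality A) {σ : A → A} where

  module _ {a rest} (paired : PairedBy σ (a ∷ rest)) where
    open PairedBy paired

    private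
      σa∈rest : σ a ∈ rest
      σa∈rest with closed (here refl)
      ... | here σa≡a = ⊥-elim (fixpoint-free (here refl) σa≡a)
      ... | there σa∈ = σa∈

      ≢σa? : ∀ x → Dec (¬ x ≡ σ a)
      ≢σa? x = ¬? (x ≟ σ a)

      a∉rest : All (λ x → ¬ a ≡ x) rest
      a∉rest with a∉ ∷ _ ← unique = a∉

      unique-rest : Unique rest
      unique-rest with _ ∷ u ← unique = u

      σ-injective : ∀ {x y} → x ∈ a ∷ rest → y ∈ a ∷ rest → σ x ≡ σ y → x ≡ y
      σ-injective x∈ y∈ eq = trans (sym (involutive x∈)) (trans (cong σ eq) (involutive y∈))

    length-dropPair : length rest ≡ suc (length (filter ≢σa? rest))
    length-dropPair = length-filter-¬-unique (_≟ σ a) unique-rest σa∈rest refl λ _ eq → eq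

    dropPair : PairedBy σ (filter ≢σa? rest)
    dropPair = record
      { unique        = filter⁺ ≢σa? unique-rest
      ; closed        = closed′
      ; involutive    = involutive ∘ there ∘ kept
      ; fixpoint-free = fixpoint-free ∘ there ∘ kept
      }
      where
        kept : ∀ {x} → x ∈ filter ≢σa? rest → x ∈ rest
        kept = proj₁ ∘ ∈-filter⁻ ≢σa?

        closed′ : ∀ {x} → x ∈ filter ≢σa? rest → σ x ∈ filter ≢σa? rest
        closed′ x∈ with x∈rest , x≢σa ← ∈-filter⁻ ≢σa? x∈ with closed (there x∈rest)
        ... | here σx≡a = ⊥-elim (x≢σa (trans (sym (involutive (there x∈rest))) (cong σ σx≡a)))
        ... | there σx∈rest = ∈-filter⁺ ≢σa? σx∈rest λ σx≡σa →
              All.lookup a∉rest x∈rest (sym (σ-injective (there x∈rest) (here refl) σx≡σa))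

  paired⇒even-length : ∀ {xs} → PairedBy σ xs → 2 ∣ length xs
  paired⇒even-length = go _ _ refl
    where
      go : ∀ k xs → length xs ≡ k → PairedBy σ xs → 2 ∣ k
      go zero          _          _  _      = 2 ∣0
      go (suc k)       []         () _
      go (suc k)       (a ∷ rest) eq paired with trans (sym eq) (cong suc (length-dropPair paired))
      go (suc (suc k)) (a ∷ rest) eq paired | refl = ∣m∣n⇒∣m+n ∣-refl (go k _ refl (dropPair paired))

module _ {A B : Set} (f : A → List B) where

  pairs : List A → List (A × B)
  pairs []       = []
  pairs (a ∷ as) = map (a ,_) (f a) ++ pairs as

  ∈-pairs⁻ : ∀ {as a b} → (a , b) ∈ pairs as → a ∈ as × b ∈ f a
  ∈-pairs⁻ {a′ ∷ as} ab∈ with ∈-++⁻ (map (a′ ,_) (f a′)) ab∈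
  ... | inj₁ ab∈head with _ , b∈ , refl ← ∈-map⁻ (a′ ,_) ab∈head = here refl , b∈
  ... | inj₂ ab∈tail with a∈ , b∈ ← ∈-pairs⁻ {as} ab∈tail = there a∈ , b∈

  ∈-pairs⁺ : ∀ {as a b} → a ∈ as → b ∈ f a → (a , b) ∈ pairs as
  ∈-pairs⁺ {a′ ∷ as} (here refl) b∈ = ∈-++⁺ˡ (∈-map⁺ (a′ ,_) b∈)
  ∈-pairs⁺ {a′ ∷ as} (there a∈)  b∈ = ∈-++⁺ʳ (map (a′ ,_) (f a′)) (∈-pairs⁺ a∈ b∈)

  pairs⁺ : ∀ {as} → Unique as → (∀ a → Unique (f a)) → Unique (pairs as)
  pairs⁺ {[]}     []           _   = []
  pairs⁺ {a ∷ as} (a∉as ∷ as!) fa! = ++⁺ (map⁺ (cong proj₂) (fa! a)) (pairs⁺ as! fa!) disjoint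
    where
      disjoint : ∀ {ab} → ab ∈ map (a ,_) (f a) × ab ∈ pairs as → ⊥
      disjoint (ab∈head , ab∈tail) with _ , _ , refl ← ∈-map⁻ (a ,_) ab∈head =
        All.lookup a∉as (proj₁ (∈-pairs⁻ ab∈tail)) refl

  -- Phrased with c = 1 + length (f a), so that the count n ∸ 1 of non-roots never appears.
  length-pairs : ∀ {c} as → (∀ {a} → a ∈ as → suc (length (f a)) ≡ c) →
                 length (pairs as) + length as ≡ length as * c
  length-pairs []       _    = refl
  length-pairs {c} (a ∷ as) size = begin
    length (map (a ,_) (f a) ++ pairs as) + suc (length as) ≡⟨ cong (_+ suc (length as)) length-head ⟩
    length (f a) + length (pairs as) + suc (length as)      ≡⟨ +-suc (length (f a) + length (pairs as)) _ ⟩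
    suc (length (f a) + length (pairs as) + length as)      ≡⟨ cong suc (+-assoc (length (f a)) _ _) ⟩
    suc (length (f a)) + (length (pairs as) + length as)    ≡⟨ cong₂ _+_ (size (here refl))
                                                                          (length-pairs as (size ∘ there)) ⟩
    c + length as * c                                       ∎
    where
      open ≡-Reasoning
      length-head : length (map (a ,_) (f a) ++ pairs as) ≡ length (f a) + length (pairs as)
      length-head = trans (length-++ (map (a ,_) (f a))) (cong (_+ length (pairs as)) (length-map (a ,_) (f a)))

module _ {A : Set} {xs : List A} (xs! : Unique xs) (∈xs : ∀ x → x ∈ xs) where

  allVecs : ∀ m → List (Vec A m)
  allVecs zero    = [] ∷ []
  allVecs (suc m) = cartesianProductWith _∷_ xs (allVecs m)

  allVecs⁺ : ∀ m → Unique (allVecs m)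
  allVecs⁺ zero    = All.[] ∷ []
  allVecs⁺ (suc m) = cartesianProductWith⁺ _∷_ ∷-injective xs! (allVecs⁺ m)
    where ∷-injective : ∀ {x y : A} {u v : Vec A m} → x ∷ u ≡ y ∷ v → x ≡ y × u ≡ v
          ∷-injective refl = refl , refl

  ∈-allVecs : ∀ {m} (v : Vec A m) → v ∈ allVecs m
  ∈-allVecs []      = here refl
  ∈-allVecs (x ∷ v) = ∈-cartesianProductWith⁺ _∷_ (∈xs x) (∈-allVecs v)

module Walks {n : ℕ} (G : Graph n) where

  adj-sym : ∀ {a b} → adj G a b ≡ true → adj G b a ≡ true
  adj-sym {a} {b} e = trans (Graph.sym G b a) e

  reach-end : ∀ {S y z} → Reach G S y z → S z
  reach-end (here s)     = s
  reach-end (step _ s _) = s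

  reach-trans : ∀ {S y z w} → Reach G S y z → Reach G S z w → Reach G S y w
  reach-trans r (here _)      = r
  reach-trans r (step r′ s e) = step (reach-trans r r′) s e

  reach-sym : ∀ {S y z} → Reach G S y z → Reach G S z y
  reach-sym (here s)     = here s
  reach-sym (step r s e) = reach-trans (step (here s) (reach-end r) (adj-sym e)) (reach-sym r)

  reach-mono : ∀ {S S′ : VSet n} → (∀ v → S v → S′ v) → ∀ {y z} → Reach G S y z → Reach G S′ y z
  reach-mono S⊆S′ (here s)     = here (S⊆S′ _ s)
  reach-mono S⊆S′ (step r s e) = step (reach-mono S⊆S′ r) (S⊆S′ _ s) e

  reach-within-component : ∀ {S y a b} → Reach G S y a → Reach G S a b → Reach G (Reach G S y) a b
  reach-within-component ya (here _)     = here ya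
  reach-within-component ya (step r s e) = step (reach-within-component ya r) (step (reach-trans ya r) s e) e

  reach-∖⊎exit : ∀ {S x y z} → Reach G S y z → (S ∖ x) y →
                 Reach G (S ∖ x) y z ⊎ Σ (Fin n) λ w → Reach G (S ∖ x) y w × adj G w x ≡ true
  reach-∖⊎exit (here _) sy = inj₁ (here sy)
  reach-∖⊎exit {x = x} (step {w = w} r s e) sy with reach-∖⊎exit r sy
  ... | inj₂ exit = inj₂ exit
  ... | inj₁ r′ with w ≟ x
  ...   | yes refl = inj₂ (_ , r′ , e)
  ...   | no w≢x   = inj₁ (step r′ (s , w≢x) e)

  ConnectedSet : VSet n → Set
  ConnectedSet S = ∀ a b → S a → S b → Reach G S a b

  connected-from : ∀ {S v} → (∀ w → S w → Reach G S v w) → ConnectedSet S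
  connected-from v⇝ a b sa sb = reach-trans (reach-sym (v⇝ a sa)) (v⇝ b sb)

  component-connected : ∀ {S y} → ConnectedSet (Reach G S y)
  component-connected a b ya yb = reach-within-component ya (reach-trans (reach-sym ya) yb)

module Ancestry {n : ℕ} where

  parent : Tree n → Fin n → Maybe (Fin n)
  parent = lookup

  climb : Tree n → ℕ → Fin n → Maybe (Fin n)
  climb t zero    v = just v
  climb t (suc k) v = parent t v >>= climb t k

  Ancestor : Tree n → Fin n → Fin n → Set
  Ancestor t u w = Σ ℕ λ k → climb t k w ≡ just u

  AncestorWithinN : Tree n → Fin n → Fin n → Set
  AncestorWithinN t u w = Σ (Fin (suc n)) λ k → climb t (toℕ k) w ≡ just u

  withinN⇒ancestor : ∀ {t u w} → AncestorWithinN t u w → Ancestor t u w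
  withinN⇒ancestor (k , e) = toℕ k , e

  Acyclic : Tree n → Set
  Acyclic t = ∀ w → climb t n w ≡ nothing

  module _ {t : Tree n} where

    climb-suc⁻ : ∀ k {z a} → climb t (suc k) z ≡ just a →
                 Σ (Fin n) λ z′ → parent t z ≡ just z′ × climb t k z′ ≡ just a
    climb-suc⁻ k {z} e with parent t z
    ... | just z′ = z′ , refl , e

    climb-suc-parent : ∀ k {z z′ a} → parent t z ≡ just z′ → climb t (suc k) z ≡ just a → climb t k z′ ≡ just a
    climb-suc-parent k pz e = trans (sym (cong (_>>= climb t k) pz)) e

    climb-+ : ∀ k m w → climb t (k + m) w ≡ (climb t k w >>= climb t m)
    climb-+ zero    m w = refl
    climb-+ (suc k) m w with parent t w
    ... | nothing = refl
    ... | just u  = climb-+ k m u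

    climb-nothing-+ : ∀ k m w → climb t k w ≡ nothing → climb t (k + m) w ≡ nothing
    climb-nothing-+ k m w e = trans (climb-+ k m w) (cong (_>>= climb t m) e)

    ancestor-refl : ∀ {w} → Ancestor t w w
    ancestor-refl = 0 , refl

    parent⇒ancestor : ∀ {c p} → parent t c ≡ just p → Ancestor t p c
    parent⇒ancestor pc = 1 , cong (_>>= climb t 0) pc

    ancestor-trans : ∀ {u w z} → Ancestor t u w → Ancestor t w z → Ancestor t u z
    ancestor-trans {z = z} (m , e₁) (k , e₂) = k + m , trans (climb-+ k m z) (trans (cong (_>>= climb t m) e₂) e₁)

    ancestor-of-parent : ∀ {u c p} → parent t c ≡ just p → Ancestor t u p → Ancestor t u c
    ancestor-of-parent pc a = ancestor-trans a (parent⇒ancestor pc)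

    ancestor-unstep : ∀ {w z} → Ancestor t w z → w ≡ z ⊎ Σ (Fin n) λ z′ → parent t z ≡ just z′ × Ancestor t w z′
    ancestor-unstep (zero , refl) = inj₁ refl
    ancestor-unstep (suc k , e) with z′ , pz , e′ ← climb-suc⁻ k e = inj₂ (z′ , pz , k , e′)

    ancestor-of-child : ∀ {w c v} → Ancestor t w c → parent t c ≡ just v → w ≡ c ⊎ Ancestor t w v
    ancestor-of-child a pc with ancestor-unstep a
    ... | inj₁ w≡c = inj₁ w≡c
    ... | inj₂ (_ , pc′ , a′) with refl ← trans (sym pc) pc′ = inj₂ a′

    climb⇒child : ∀ k {y v} → climb t (suc k) y ≡ just v → Σ (Fin n) λ c → parent t c ≡ just v × Ancestor t c y
    climb⇒child zero    {y} e with _ , py , refl ← climb-suc⁻ 0 e = y , py , ancestor-refl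
    climb⇒child (suc k) {y} e with _ , py , e′ ← climb-suc⁻ (suc k) e with c , pc , a ← climb⇒child k e′ =
      c , pc , ancestor-of-parent py a

    proper-ancestor⇒child : ∀ {v y} → Ancestor t v y → ¬ y ≡ v → Σ (Fin n) λ c → parent t c ≡ just v × Ancestor t c y
    proper-ancestor⇒child (zero , e)  y≢v = ⊥-elim (y≢v (just-injective e))
    proper-ancestor⇒child (suc k , e) _   = climb⇒child k e

    ancestors-comparable : ∀ {a b z} → Ancestor t a z → Ancestor t b z → Ancestor t a b ⊎ Ancestor t b a
    ancestors-comparable (k , e₁) (m , e₂) = go k m _ e₁ e₂
      where
        go : ∀ {a b} k m z → climb t k z ≡ just a → climb t m z ≡ just b → Ancestor t a b ⊎ Ancestor t b a
        go zero    m       z refl e₂   = inj₂ (m , e₂)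
        go (suc k) zero    z e₁   refl = inj₁ (suc k , e₁)
        go (suc k) (suc m) z e₁   e₂   with parent t z
        ... | just z′ = go k m z′ e₁ e₂

    climb-to-root : ∀ k w → climb t k w ≡ nothing → Σ (Fin n) λ r → Ancestor t r w × parent t r ≡ nothing
    climb-to-root (suc k) w e with parent t w in pw
    ... | nothing = w , ancestor-refl , pw
    ... | just w′ with r , a , pr ← climb-to-root k w′ e = r , ancestor-of-parent pw a , pr

    climb-cycle : ∀ {j b} → climb t (suc j) b ≡ just b → ∀ m → climb t (m * suc j) b ≡ just b
    climb-cycle         e zero    = refl
    climb-cycle {j} {b} e (suc m) =
      trans (climb-+ (suc j) (m * suc j) b) (trans (cong (_>>= climb t (m * suc j)) e) (climb-cycle e m))

    -- Going round the cycle k times from a lands at a again, but after at least k steps from w.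
    escape⇒¬cycle : ∀ {w a} k i d → climb t k w ≡ nothing → climb t i w ≡ just a → climb t (suc d) a ≡ just a → ⊥
    escape⇒¬cycle {w} {a} k i d escape ia cycle =
      case trans (sym around) (climb-nothing-+ k (i + k * d) w escape) of λ ()
      where
        open ≡-Reasoning
        around : climb t (k + (i + k * d)) w ≡ just a
        around = begin
          climb t (k + (i + k * d)) w     ≡⟨ cong (λ m → climb t m w) (+-comm-middle k i (k * d)) ⟩
          climb t (i + (k + k * d)) w     ≡⟨ cong (λ m → climb t (i + m) w) (sym (*-suc k d)) ⟩
          climb t (i + k * suc d) w       ≡⟨ climb-+ i (k * suc d) w ⟩
          (climb t i w >>= climb t (k * suc d)) ≡⟨ cong (_>>= climb t (k * suc d)) ia ⟩
          climb t (k * suc d) a           ≡⟨ climb-cycle cycle k ⟩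
          just a                          ∎
          where +-comm-middle : ∀ x y z → x + (y + z) ≡ y + (x + z)
                +-comm-middle x y z = trans (sym (+-assoc x y z)) (trans (cong (_+ z) (+-comm x y)) (+-assoc y x z))

    climb-survives : ∀ {w b} → climb t n w ≡ just b → ∀ i → i ≤ n → Σ (Fin n) λ a → climb t i w ≡ just a
    climb-survives {w} climb-n i i≤n with climb t i w in climb-i
    ... | just a  = a , refl
    ... | nothing with o , i+o≡n ← m≤n⇒∃[o]m+o≡n i≤n =
      case trans (sym (climb-nothing-+ i o w climb-i)) (trans (cong (λ m → climb t m w) i+o≡n) climb-n) of λ ()

    -- If the climb from w survived n steps, pigeonhole finds a repeated vertex among the first n + 1, i.e. a cycle.
    escape⇒climb-n-nothing : ∀ k w → climb t k w ≡ nothing → climb t n w ≡ nothing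
    escape⇒climb-n-nothing k w escape with climb t n w in climb-n
    ... | nothing = refl
    ... | just _  = ⊥-elim (repeat⇒⊥ (pigeonhole (n<1+n n) vertexAt))
      where
        vertexAt : Fin (suc n) → Fin n
        vertexAt i = proj₁ (climb-survives climb-n (toℕ i) (toℕ≤pred[n] i))

        climb-vertexAt : ∀ i → climb t (toℕ i) w ≡ just (vertexAt i)
        climb-vertexAt i = proj₂ (climb-survives climb-n (toℕ i) (toℕ≤pred[n] i))

        repeat⇒⊥ : Σ (Fin (suc n)) (λ i → Σ (Fin (suc n)) λ j → i Data.Fin.< j × vertexAt i ≡ vertexAt j) → ⊥
        repeat⇒⊥ (i , j , i<j , fi≡fj) with d , i+1+d≡j ← m≤n⇒∃[o]m+o≡n i<j =
          escape⇒¬cycle k (toℕ i) d escape (climb-vertexAt i) cycle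
          where
            open ≡-Reasoning
            cycle : climb t (suc d) (vertexAt i) ≡ just (vertexAt i)
            cycle = begin
              climb t (suc d) (vertexAt i)                  ≡⟨ cong (_>>= climb t (suc d)) (climb-vertexAt i) ⟨
              (climb t (toℕ i) w >>= climb t (suc d))       ≡⟨ climb-+ (toℕ i) (suc d) w ⟨
              climb t (toℕ i + suc d) w                     ≡⟨ cong (λ m → climb t m w) (trans (+-suc _ d) i+1+d≡j) ⟩
              climb t (toℕ j) w                             ≡⟨ climb-vertexAt j ⟩
              just (vertexAt j)                             ≡⟨ cong just fi≡fj ⟨
              just (vertexAt i)                             ∎

    reachable-root⇒acyclic : ∀ {x} → parent t x ≡ nothing → (∀ w → Ancestor t x w) → Acyclic t
    reachable-root⇒acyclic px ancestor w with k , e ← ancestor w =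
      escape⇒climb-n-nothing (k + 1) w
        (trans (climb-+ k 1 w) (trans (cong (_>>= climb t 1) e) (cong (_>>= climb t 0) px)))

    module _ (acyclic : Acyclic t) where

      acyclic⇒¬cycle : ∀ j {b} → climb t (suc j) b ≡ just b → ⊥
      acyclic⇒¬cycle j {b} = escape⇒¬cycle n 0 j (acyclic b) refl

      ancestor-antisym : ∀ {a b} → Ancestor t a b → Ancestor t b a → a ≡ b
      ancestor-antisym (zero , refl) _ = refl
      ancestor-antisym {a} {b} (suc k , e₁) (m , e₂) =
        ⊥-elim (acyclic⇒¬cycle (k + m) (trans (climb-+ (suc k) m b) (trans (cong (_>>= climb t m) e₁) e₂)))

      parent≢self : ∀ {c} → parent t c ≡ just c → ⊥
      parent≢self pc = acyclic⇒¬cycle 0 (cong (_>>= climb t 0) pc)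

      parent-not-descendant : ∀ {c v} → parent t c ≡ just v → Ancestor t c v → ⊥
      parent-not-descendant pc a with refl ← ancestor-antisym a (parent⇒ancestor pc) = parent≢self pc

      parent-chain-distinct : ∀ {c v p} → parent t c ≡ just v → parent t v ≡ just p → ¬ c ≡ v × ¬ c ≡ p
      parent-chain-distinct cv vp =
        (λ { refl → parent≢self cv }) , λ { refl → parent-not-descendant cv (parent⇒ancestor vp) }

      sibling-not-ancestor : ∀ {a b p} → parent t a ≡ just p → parent t b ≡ just p → ¬ a ≡ b → ¬ Ancestor t a b
      sibling-not-ancestor ap bp a≢b ab with ancestor-of-child ab bp
      ... | inj₁ a≡b = a≢b a≡b
      ... | inj₂ ap′ = parent-not-descendant ap ap′

      only-root⇒ancestor : ∀ {x} → (∀ w → parent t w ≡ nothing → w ≡ x) → ∀ w → Ancestor t x w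
      only-root⇒ancestor only-root w with r , rw , pr ← climb-to-root n w (acyclic w) with refl ← only-root r pr = rw

      ancestor⇒withinN : ∀ {u w} → Ancestor t u w → AncestorWithinN t u w
      ancestor⇒withinN {w = w} (k , e) with k <? suc n
      ... | yes k<1+n = fromℕ< k<1+n , trans (cong (λ m → climb t m w) (toℕ-fromℕ< k<1+n)) e
      ... | no  k≮1+n with o , n+o≡k ← m≤n⇒∃[o]m+o≡n (<⇒≤ (≮⇒≥ k≮1+n)) =
        case trans (sym (climb-nothing-+ n o w (acyclic w))) (trans (cong (λ m → climb t m w) n+o≡k) e) of λ ()

  ancestorWithinN? : ∀ t u w → Dec (AncestorWithinN t u w)
  ancestorWithinN? t u w = any? λ k → ≡-decᴹ _≟_ (climb t (toℕ k) w) (just u)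

  ancestor? : ∀ {t} → Acyclic t → ∀ u w → Dec (Ancestor t u w)
  ancestor? acyclic u w = map′ withinN⇒ancestor (ancestor⇒withinN acyclic) (ancestorWithinN? _ u w)

module Characterisation {n : ℕ} (G : Graph n) where
  open Walks G
  open Ancestry

  UniqueRoot : Tree n → Set
  UniqueRoot t = Σ (Fin n) λ x → parent t x ≡ nothing × (∀ w → parent t w ≡ nothing → w ≡ x)

  SubtreeAdjacent : Tree n → Fin n → Fin n → Set
  SubtreeAdjacent t p c = Σ (Fin n) λ w → Ancestor t c w × adj G p w ≡ true

  record IsElimTreeᴬ (t : Tree n) : Set where
    field
      acyclic          : Acyclic t
      root             : UniqueRoot t
      edge-comparable  : ∀ a b → adj G a b ≡ true → Ancestor t a b ⊎ Ancestor t b a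
      subtree-adjacent : ∀ c p → parent t c ≡ just p → SubtreeAdjacent t p c

  module _ {t : Tree n} where

    et-root-ancestor : ∀ {S x} → ET G t S x → ∀ v → S v → Ancestor t x v
    et-root-ancestor {S} {x} (node _ sub) v sv with v ≟ x
    ... | yes refl = ancestor-refl
    ... | no v≢x with _ , _ , pr , et ← sub v (sv , v≢x) =
      ancestor-trans (parent⇒ancestor pr) (et-root-ancestor et v (here (sv , v≢x)))

    et-has-parent : ∀ {S x} → ET G t S x → ∀ v → S v → ¬ v ≡ x → Σ (Fin n) λ p → parent t v ≡ just p
    et-has-parent (node _ sub) v sv v≢x with r , _ , pr , et ← sub v (sv , v≢x) with v ≟ r
    ... | yes refl = _ , pr
    ... | no v≢r   = et-has-parent et v (here (sv , v≢x)) v≢r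

    et-edge-comparable : ∀ {S x} → ET G t S x → ∀ a b → S a → S b → adj G a b ≡ true →
                         Ancestor t a b ⊎ Ancestor t b a
    et-edge-comparable {S} {x} et@(node _ sub) a b sa sb e with a ≟ x | b ≟ x
    ... | yes refl | _        = inj₁ (et-root-ancestor et b sb)
    ... | no _     | yes refl = inj₂ (et-root-ancestor et a sa)
    ... | no a≢x   | no b≢x with _ , _ , _ , et′ ← sub a (sa , a≢x) =
      et-edge-comparable et′ a b (here (sa , a≢x)) (step (here (sa , a≢x)) (sb , b≢x) e) e

    -- A child c of x roots a whole component of G[S] - x, so a walk in S from c to x leaves that
    -- component through a neighbour of x.
    et-subtree-adjacent : ∀ {S x} → ET G t S x → ConnectedSet S → ∀ c p → S c → ¬ c ≡ x → parent t c ≡ just p →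
                          SubtreeAdjacent t p c
    et-subtree-adjacent {S} {x} (node sx sub) S-connected c p sc c≢x pc
      with r , _ , pr , et ← sub c (sc , c≢x) with c ≟ r
    ... | no c≢r = et-subtree-adjacent et component-connected c p (here (sc , c≢x)) c≢r pc
    ... | yes refl with refl ← trans (sym pc) pr with reach-∖⊎exit {x = x} (S-connected c x sc sx) (sc , c≢x)
    ...   | inj₁ c⇝x            = ⊥-elim (proj₂ (reach-end c⇝x) refl)
    ...   | inj₂ (w , c⇝w , e) = w , et-root-ancestor et w c⇝w , adj-sym e

  isElimTree⇒ᴬ : Connected G → ∀ {t} → IsElimTree G t → IsElimTreeᴬ t
  isElimTree⇒ᴬ connected {t} (x , px , et) = record
    { acyclic          = acyclic
    ; root             = x , px , only-root
    ; edge-comparable  = λ a b → et-edge-comparable et a b tt tt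
    ; subtree-adjacent = subtree-adjacent
    }
    where
      acyclic : Acyclic t
      acyclic = reachable-root⇒acyclic px λ w → et-root-ancestor et w tt

      only-root : ∀ w → parent t w ≡ nothing → w ≡ x
      only-root w pw with w ≟ x
      ... | yes w≡x = w≡x
      ... | no w≢x with _ , pw′ ← et-has-parent et w tt w≢x = case trans (sym pw) pw′ of λ ()

      subtree-adjacent : ∀ c p → parent t c ≡ just p → SubtreeAdjacent t p c
      subtree-adjacent c p pc with c ≟ x
      ... | yes refl = case trans (sym px) pc of λ ()
      ... | no c≢x   = et-subtree-adjacent et (λ a b _ _ → connected a b) c p tt c≢x pc

  module _ {t : Tree n} where

    ET-resp : ∀ {S S′ : VSet n} {x} → (∀ v → S v → S′ v) → (∀ v → S′ v → S v) → ET G t S x → ET G t S′ x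
    ET-resp {S} {S′} {x} S⊆S′ S′⊆S (node sx sub) = node (S⊆S′ _ sx) sub′
      where
        ∖⊆ : ∀ v → (S ∖ x) v → (S′ ∖ x) v
        ∖⊆ v (s , v≢x) = S⊆S′ v s , v≢x
        ∖⊇ : ∀ v → (S′ ∖ x) v → (S ∖ x) v
        ∖⊇ v (s , v≢x) = S′⊆S v s , v≢x
        sub′ : ∀ y → (S′ ∖ x) y →
               Σ (Fin n) λ r → Reach G (S′ ∖ x) y r × parent t r ≡ just x × ET G t (Reach G (S′ ∖ x) y) r
        sub′ y sy with r , y⇝r , pr , et ← sub y (∖⊇ y sy) =
          r , reach-mono ∖⊆ y⇝r , pr , ET-resp (λ _ → reach-mono ∖⊆) (λ _ → reach-mono ∖⊇) et

  module _ {t : Tree n} (ᴬ : IsElimTreeᴬ t) where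
    open IsElimTreeᴬ ᴬ

    sibling-subtree-not-adjacent : ∀ {a b p} → parent t a ≡ just p → parent t b ≡ just p → ¬ a ≡ b →
                                   ¬ SubtreeAdjacent t a b
    sibling-subtree-not-adjacent ap bp a≢b (w , bw , e) with edge-comparable _ w e
    ... | inj₂ wa = sibling-not-ancestor acyclic bp ap (a≢b ∘ sym) (ancestor-trans bw wa)
    ... | inj₁ aw with ancestors-comparable aw bw
    ...   | inj₁ ab = sibling-not-ancestor acyclic ap bp a≢b ab
    ...   | inj₂ ba = sibling-not-ancestor acyclic bp ap (a≢b ∘ sym) ba

    Subtree : Fin n → VSet n
    Subtree = Ancestor t

    SubtreeIsElim : Fin n → Set₁
    SubtreeIsElim v = ET G t (Subtree v) v × ConnectedSet (Subtree v)

    subtree-child⊆∖ : ∀ {c v} → parent t c ≡ just v → ∀ w → Subtree c w → (Subtree v ∖ v) w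
    subtree-child⊆∖ pc w cw = ancestor-trans (parent⇒ancestor pc) cw , λ { refl → parent-not-descendant acyclic pc cw }

    -- An edge leaving the subtree of c inside Subtree v ∖ v would have to go above c, i.e. through v.
    component⊆subtree-child : ∀ {c v y w} → parent t c ≡ just v → Subtree c y → Reach G (Subtree v ∖ v) y w → Subtree c w
    component⊆subtree-child pc cy (here _) = cy
    component⊆subtree-child pc cy (step {z = z} {w = w} y⇝z (vw , w≢v) e)
      with cz ← component⊆subtree-child pc cy y⇝z with edge-comparable z w e
    ... | inj₁ zw = ancestor-trans cz zw
    ... | inj₂ wz with ancestors-comparable wz cz
    ...   | inj₂ cw = cw
    ...   | inj₁ wc with ancestor-of-child wc pc
    ...     | inj₁ refl = ancestor-refl
    ...     | inj₂ wv   = ⊥-elim (w≢v (ancestor-antisym acyclic wv vw))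

    subtree-child⊆component : ∀ {c v y} → parent t c ≡ just v → SubtreeIsElim c → Subtree c y →
                              ∀ w → Subtree c w → Reach G (Subtree v ∖ v) y w
    subtree-child⊆component pc (_ , c-connected) cy w cw = reach-mono (subtree-child⊆∖ pc) (c-connected _ w cy cw)

    subtree-connected : ∀ {v} → (∀ {c} → parent t c ≡ just v → SubtreeIsElim c) →
                        ∀ w → Subtree v w → Reach G (Subtree v) v w
    subtree-connected {v} children w vw with w ≟ v
    ... | yes refl = here ancestor-refl
    ... | no w≢v with c , pc , cw ← proper-ancestor⇒child vw w≢v with z , cz , e ← subtree-adjacent c v pc =
      reach-trans (step (here ancestor-refl) (ancestor-trans (parent⇒ancestor pc) cz) e)
                  (reach-mono (λ _ → proj₁ ∘ subtree-child⊆∖ pc _) (proj₂ (children pc) z w cz cw))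

    subtree-isElim : ∀ {v} → (∀ {c} → parent t c ≡ just v → SubtreeIsElim c) → SubtreeIsElim v
    subtree-isElim {v} children = node ancestor-refl component , connected-from (subtree-connected children)
      where
        component : ∀ y → (Subtree v ∖ v) y → Σ (Fin n) λ r → Reach G (Subtree v ∖ v) y r × parent t r ≡ just v
                                                           × ET G t (Reach G (Subtree v ∖ v) y) r
        component y (vy , y≢v) with c , pc , cy ← proper-ancestor⇒child vy y≢v =
          c , ⊆component c ancestor-refl , pc , ET-resp ⊆component ⊇component (proj₁ (children pc))
          where
            ⊆component : ∀ w → Subtree c w → Reach G (Subtree v ∖ v) y w
            ⊆component = subtree-child⊆component pc (children pc) cy
            ⊇component : ∀ w → Reach G (Subtree v ∖ v) y w → Subtree c w
            ⊇component _ = component⊆subtree-child pc cy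

    -- Downward induction on depth: no vertex has depth n, and a vertex of depth d has children of depth d + 1.
    deep-subtree-isElim : ∀ i d → i + d ≡ n → ∀ v → ¬ climb t d v ≡ nothing → SubtreeIsElim v
    deep-subtree-isElim zero    d refl v deep = ⊥-elim (deep (acyclic v))
    deep-subtree-isElim (suc i) d i+1+d≡n v deep = subtree-isElim λ {c} pc →
      deep-subtree-isElim i (suc d) (trans (+-suc i d) i+1+d≡n) c λ shallow →
        deep (trans (sym (cong (_>>= climb t d) pc)) shallow)

    ᴬ⇒isElimTree : IsElimTree G t
    ᴬ⇒isElimTree with x , px , only-root ← root =
      x , px , ET-resp (λ _ _ → tt) (λ w _ → only-root⇒ancestor acyclic only-root w)
                       (proj₁ (deep-subtree-isElim n 0 (+-comm n 0) x λ ()))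

  isElimTreeᴬ? : ∀ t → Dec (IsElimTreeᴬ t)
  isElimTreeᴬ? t with all? (λ w → ≡-decᴹ _≟_ (climb t n w) nothing)
  ... | no ¬acyclic = no (¬acyclic ∘ IsElimTreeᴬ.acyclic)
  ... | yes acyclic =
    map′ (λ (r , c , s) → record { acyclic = acyclic ; root = r ; edge-comparable = c ; subtree-adjacent = s })
         (λ ᴬ → IsElimTreeᴬ.root ᴬ , IsElimTreeᴬ.edge-comparable ᴬ , IsElimTreeᴬ.subtree-adjacent ᴬ)
         (root? ×-dec edge-comparable? ×-dec subtree-adjacent?)
    where
      ancestor?′ : ∀ u w → Dec (Ancestor t u w)
      ancestor?′ = ancestor? acyclic

      root? : Dec (UniqueRoot t)
      root? = any? λ x → ≡-decᴹ _≟_ (parent t x) nothing ×-dec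
                         all? λ w → ≡-decᴹ _≟_ (parent t w) nothing →-dec (w ≟ x)

      edge-comparable? : Dec (∀ a b → adj G a b ≡ true → Ancestor t a b ⊎ Ancestor t b a)
      edge-comparable? = all? λ a → all? λ b → (adj G a b Bool.≟ true) →-dec (ancestor?′ a b ⊎-dec ancestor?′ b a)

      subtree-adjacent? : Dec (∀ c p → parent t c ≡ just p → SubtreeAdjacent t p c)
      subtree-adjacent? = all? λ c → all? λ p →
        ≡-decᴹ _≟_ (parent t c) (just p) →-dec any? λ w → ancestor?′ c w ×-dec (adj G p w Bool.≟ true)

module Rotation {n : ℕ} (G : Graph n) where
  open Walks G
  open Ancestry
  open Characterisation G

  record Rotated (t₁ t₂ : Tree n) (v p : Fin n) : Set where
    field
      v≢p        : ¬ v ≡ p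
      v→p        : parent t₁ v ≡ just p
      p→v        : parent t₂ p ≡ just v
      v-inherits : parent t₂ v ≡ parent t₁ p
      others     : ∀ w → ¬ w ≡ v → ¬ w ≡ p →
                   parent t₂ w ≡ parent t₁ w ⊎ (parent t₁ w ≡ just v × parent t₂ w ≡ just p)

  rotated-sym : ∀ {t₁ t₂ v p} → Rotated t₁ t₂ v p → Rotated t₂ t₁ p v
  rotated-sym R = record
    { v≢p        = v≢p ∘ sym
    ; v→p        = p→v
    ; p→v        = v→p
    ; v-inherits = sym v-inherits
    ; others     = λ w w≢p w≢v → Sum.map sym Product.swap (others w w≢v w≢p)
    }
    where open Rotated R

  module Transfer {t₁ t₂ v p} (R : Rotated t₁ t₂ v p) where
    open Rotated R

    module _ {a} (a≢v : ¬ a ≡ v) (a≢p : ¬ a ≡ p) where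
      climb-preserved : ∀ k z → climb t₁ k z ≡ just a → Ancestor t₂ a z
      climb-above-p   : ∀ k → climb t₁ k p ≡ just a → Ancestor t₂ a v
      climb-above-v   : ∀ k → climb t₁ k v ≡ just a → Ancestor t₂ a v

      climb-above-p zero    e = ⊥-elim (a≢p (sym (just-injective e)))
      climb-above-p (suc k) e with g , pg , e′ ← climb-suc⁻ k e =
        ancestor-of-parent (trans v-inherits pg) (climb-preserved k g e′)

      climb-above-v zero    e = ⊥-elim (a≢v (sym (just-injective e)))
      climb-above-v (suc k) e = climb-above-p k (climb-suc-parent k v→p e)

      climb-preserved zero    z e with refl ← just-injective e = ancestor-refl
      climb-preserved (suc k) z e with z ≟ v | z ≟ p
      ... | yes refl | _        = climb-above-p k (climb-suc-parent k v→p e)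
      ... | no _     | yes refl with g , pg , e′ ← climb-suc⁻ k e =
        ancestor-of-parent p→v (ancestor-of-parent (trans v-inherits pg) (climb-preserved k g e′))
      ... | no z≢v   | no z≢p with z′ , pz , e′ ← climb-suc⁻ k e with others z z≢v z≢p
      ...   | inj₁ same = ancestor-of-parent (trans same pz) (climb-preserved k z′ e′)
      ...   | inj₂ (zv , zp) with refl ← trans (sym pz) zv =
        ancestor-of-parent zp (ancestor-of-parent p→v (climb-above-v k e′))

    climb-below-v : ∀ k z → climb t₂ k z ≡ just v → Ancestor t₁ p z
    climb-below-v zero    z e with refl ← just-injective e = parent⇒ancestor v→p
    climb-below-v (suc k) z e with z ≟ v | z ≟ p
    ... | yes refl | _        = parent⇒ancestor v→p
    ... | no _     | yes refl = ancestor-refl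
    ... | no z≢v   | no z≢p with z′ , pz , e′ ← climb-suc⁻ k e with others z z≢v z≢p
    ...   | inj₁ same     = ancestor-of-parent (trans (sym same) pz) (climb-below-v k z′ e′)
    ...   | inj₂ (zv , _) = ancestor-of-parent zv (parent⇒ancestor v→p)

    climb-below-p : ∀ k z → climb t₁ k z ≡ just p →
                    z ≡ v ⊎ Ancestor t₂ p z ⊎
                    Σ (Fin n) λ c → parent t₁ c ≡ just v × parent t₂ c ≡ just v × Ancestor t₁ c z
    climb-below-p zero    z e with refl ← just-injective e = inj₂ (inj₁ ancestor-refl)
    climb-below-p (suc k) z e with z ≟ v | z ≟ p
    ... | yes refl | _        = inj₁ refl
    ... | no _     | yes refl = inj₂ (inj₁ ancestor-refl)
    ... | no z≢v   | no z≢p with z′ , pz , e′ ← climb-suc⁻ k e with others z z≢v z≢p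
    ...   | inj₂ (_ , zp) = inj₂ (inj₁ (parent⇒ancestor zp))
    ...   | inj₁ same with climb-below-p k z′ e′
    ...     | inj₁ refl                    = inj₂ (inj₂ (z , pz , trans same pz , ancestor-refl))
    ...     | inj₂ (inj₁ pz′)              = inj₂ (inj₁ (ancestor-of-parent (trans same pz) pz′))
    ...     | inj₂ (inj₂ (c , cv , cv′ , cz′)) = inj₂ (inj₂ (c , cv , cv′ , ancestor-of-parent pz cz′))

    ancestor-preserved : ∀ {a z} → ¬ a ≡ v → ¬ a ≡ p → Ancestor t₁ a z → Ancestor t₂ a z
    ancestor-preserved a≢v a≢p (k , e) = climb-preserved a≢v a≢p k _ e

    below-v⇒below-p : ∀ {z} → Ancestor t₂ v z → Ancestor t₁ p z
    below-v⇒below-p (k , e) = climb-below-v k _ e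

    below-p-cases : ∀ {z} → Ancestor t₁ p z →
                    z ≡ v ⊎ Ancestor t₂ p z ⊎
                    Σ (Fin n) λ c → parent t₁ c ≡ just v × parent t₂ c ≡ just v × Ancestor t₁ c z
    below-p-cases (k , e) = climb-below-p k _ e

  module Preservation {t₁ t₂ v p} (R : Rotated t₁ t₂ v p) (ᴬ : IsElimTreeᴬ t₁)
    (handover : ∀ {c} → parent t₁ c ≡ just v → parent t₂ c ≡ just p ⇔ SubtreeAdjacent t₁ p c) where
    open Rotated R
    open IsElimTreeᴬ ᴬ
    open Transfer R
    open Transfer (rotated-sym R) using () renaming (below-v⇒below-p to below-p⇒below-v)

    kept-child-not-adjacent : ∀ {c} → parent t₁ c ≡ just v → parent t₂ c ≡ just v → ¬ SubtreeAdjacent t₁ p c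
    kept-child-not-adjacent cv cv′ c-adj =
      v≢p (just-injective (trans (sym cv′) (Equivalence.from (handover cv) c-adj)))

    new-root⇒old-root : ∀ {w} → parent t₂ w ≡ nothing → w ≡ v ⊎ parent t₁ w ≡ nothing
    new-root⇒old-root {w} pw with w ≟ v | w ≟ p
    ... | yes w≡v  | _        = inj₁ w≡v
    ... | no _     | yes refl = case trans (sym pw) p→v of λ ()
    ... | no w≢v   | no w≢p with others w w≢v w≢p
    ...   | inj₁ same     = inj₂ (trans (sym same) pw)
    ...   | inj₂ (_ , wp) = case trans (sym pw) wp of λ ()

    -- The root is v if p was the root, and the old root otherwise.
    new-root : Σ (Fin n) λ x → parent t₂ x ≡ nothing × (∀ w → parent t₂ w ≡ nothing → w ≡ x) ×
                               (∀ w → Ancestor t₂ x w)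
    new-root with x , px , only-root ← root with parent t₁ p in pp
    ... | nothing with refl ← only-root p pp =
      v , trans v-inherits pp , only-v , below-p⇒below-v ∘ only-root⇒ancestor acyclic only-root
      where
        only-v : ∀ w → parent t₂ w ≡ nothing → w ≡ v
        only-v w pw with new-root⇒old-root pw
        ... | inj₁ w≡v = w≡v
        ... | inj₂ pw′ with refl ← only-root w pw′ = case trans (sym pw) p→v of λ ()
    ... | just g = x , px′ , only-x , ancestor-preserved x≢v x≢p ∘ only-root⇒ancestor acyclic only-root
      where
        x≢v : ¬ x ≡ v
        x≢v refl = case trans (sym px) v→p of λ ()
        x≢p : ¬ x ≡ p
        x≢p refl = case trans (sym px) pp of λ ()
        px′ : parent t₂ x ≡ nothing
        px′ with others x x≢v x≢p
        ... | inj₁ same     = trans same px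
        ... | inj₂ (xv , _) = case trans (sym px) xv of λ ()
        only-x : ∀ w → parent t₂ w ≡ nothing → w ≡ x
        only-x w pw with new-root⇒old-root pw
        ... | inj₁ refl = case trans (sym pw) (trans v-inherits pp) of λ ()
        ... | inj₂ pw′  = only-root w pw′

    edge-comparable-below : ∀ a b → adj G a b ≡ true → Ancestor t₁ a b → Ancestor t₂ a b ⊎ Ancestor t₂ b a
    edge-comparable-below a b e ab with a ≟ v | a ≟ p
    ... | yes refl | _        = inj₁ (below-p⇒below-v (ancestor-trans (parent⇒ancestor v→p) ab))
    ... | no a≢v   | no a≢p   = inj₁ (ancestor-preserved a≢v a≢p ab)
    ... | no _     | yes refl with below-p-cases ab
    ...   | inj₁ refl                        = inj₂ (parent⇒ancestor p→v)
    ...   | inj₂ (inj₁ pb)                   = inj₁ pb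
    ...   | inj₂ (inj₂ (c , cv , cv′ , cb)) = ⊥-elim (kept-child-not-adjacent cv cv′ (b , cb , e))

    edge-comparable₂ : ∀ a b → adj G a b ≡ true → Ancestor t₂ a b ⊎ Ancestor t₂ b a
    edge-comparable₂ a b e with edge-comparable a b e
    ... | inj₁ ab = edge-comparable-below a b e ab
    ... | inj₂ ba = Sum.swap (edge-comparable-below b a (adj-sym e) ba)

    -- For c = p, the neighbour of p below v lies either at v itself or below a child of v handed over to p,
    -- whose subtree in turn touches v.
    subtree-adjacent₂ : ∀ c q → parent t₂ c ≡ just q → SubtreeAdjacent t₂ q c
    subtree-adjacent₂ c q cq with c ≟ v | c ≟ p
    ... | yes refl | _ with w , pw , e ← subtree-adjacent p q (trans (sym v-inherits) cq) = w , below-p⇒below-v pw , e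
    subtree-adjacent₂ c q cq | no _ | yes refl with refl ← trans (sym cq) p→v
      with z , vz , e ← subtree-adjacent v p v→p with z ≟ v
    ... | yes refl = p , ancestor-refl , adj-sym e
    ... | no z≢v with c′ , c′v , c′z ← proper-ancestor⇒child vz z≢v
      with c′≢v , c′≢p ← parent-chain-distinct acyclic c′v v→p with z′ , c′z′ , e′ ← subtree-adjacent c′ v c′v =
      z′ , ancestor-trans (parent⇒ancestor (Equivalence.from (handover c′v) (z , c′z , e)))
                          (ancestor-preserved c′≢v c′≢p c′z′) , e′
    subtree-adjacent₂ c q cq | no c≢v | no c≢p with others c c≢v c≢p
    ... | inj₁ same with w , cw , e ← subtree-adjacent c q (trans (sym same) cq) = w , ancestor-preserved c≢v c≢p cw , e
    ... | inj₂ (cv , cp) with refl ← trans (sym cq) cp with w , cw , e ← Equivalence.to (handover cv) cp =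
      w , ancestor-preserved c≢v c≢p cw , e

    isElimTreeᴬ₂ : IsElimTreeᴬ t₂
    isElimTreeᴬ₂ with x , px , only-x , everywhere ← new-root = record
      { acyclic          = reachable-root⇒acyclic px everywhere
      ; root             = x , px , only-x
      ; edge-comparable  = edge-comparable₂
      ; subtree-adjacent = subtree-adjacent₂
      }

  rotated-unique : ∀ {t s s′ v p} → Rotated t s v p → Rotated t s′ v p →
                   (∀ {c} → parent t c ≡ just v → parent s c ≡ parent s′ c) → s ≡ s′
  rotated-unique {t} {s} {s′} {v} {p} R R′ children =
    trans (sym (tabulate∘lookup s)) (trans (tabulate-cong same-parent) (tabulate∘lookup s′))
    where
      open Rotated
      same-parent : ∀ w → parent s w ≡ parent s′ w
      same-parent w with w ≟ v | w ≟ p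
      ... | yes refl | _        = trans (v-inherits R) (sym (v-inherits R′))
      ... | no _     | yes refl = trans (p→v R) (sym (p→v R′))
      ... | no w≢v   | no w≢p with others R w w≢v w≢p | others R′ w w≢v w≢p
      ...   | inj₁ same | inj₁ same′     = trans same (sym same′)
      ...   | inj₂ (wv , _) | _          = children wv
      ...   | inj₁ _ | inj₂ (wv , _)     = children wv

  -- Ancestry is bounded by n steps so that the decision, and with it rotateAt, is defined on every parent vector.
  HandedOver : Tree n → Fin n → Fin n → Fin n → Set
  HandedOver t v p c = parent t c ≡ just v × Σ (Fin n) λ z → AncestorWithinN t c z × adj G p z ≡ true

  handedOver? : ∀ t v p c → Dec (HandedOver t v p c)
  handedOver? t v p c =
    ≡-decᴹ _≟_ (parent t c) (just v) ×-dec any? λ z → ancestorWithinN? t c z ×-dec (adj G p z Bool.≟ true)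

  rotatedParent : Tree n → Fin n → Fin n → Fin n → Maybe (Fin n)
  rotatedParent t v p w with w ≟ v | w ≟ p | handedOver? t v p w
  ... | yes _ | _     | _     = parent t p
  ... | no _  | yes _ | _     = just v
  ... | no _  | no _  | yes _ = just p
  ... | no _  | no _  | no _  = parent t w

  rotateAt : Tree n → Fin n → Fin n → Tree n
  rotateAt t v p = tabulate (rotatedParent t v p)

  module _ {t : Tree n} {v p : Fin n} where
    private
      parent-rotateAt : ∀ w → parent (rotateAt t v p) w ≡ rotatedParent t v p w
      parent-rotateAt = lookup∘tabulate (rotatedParent t v p)

    parent-rotateAt-v : parent (rotateAt t v p) v ≡ parent t p
    parent-rotateAt-v = trans (parent-rotateAt v) rotatedParent-v
      where
        rotatedParent-v : rotatedParent t v p v ≡ parent t p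
        rotatedParent-v with v ≟ v | v ≟ p | handedOver? t v p v
        ... | yes _  | _ | _ = refl
        ... | no v≢v | _ | _ = ⊥-elim (v≢v refl)

    parent-rotateAt-p : ¬ p ≡ v → parent (rotateAt t v p) p ≡ just v
    parent-rotateAt-p p≢v = trans (parent-rotateAt p) rotatedParent-p
      where
        rotatedParent-p : rotatedParent t v p p ≡ just v
        rotatedParent-p with p ≟ v | p ≟ p | handedOver? t v p p
        ... | yes p≡v | _      | _ = ⊥-elim (p≢v p≡v)
        ... | no _    | yes _  | _ = refl
        ... | no _    | no p≢p | _ = ⊥-elim (p≢p refl)

    parent-rotateAt-other : ∀ w → ¬ w ≡ v → ¬ w ≡ p →
                            HandedOver t v p w × parent (rotateAt t v p) w ≡ just p
                            ⊎ ¬ HandedOver t v p w × parent (rotateAt t v p) w ≡ parent t w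
    parent-rotateAt-other w w≢v w≢p rewrite parent-rotateAt w with w ≟ v | w ≟ p | handedOver? t v p w
    ... | yes w≡v | _       | _      = ⊥-elim (w≢v w≡v)
    ... | no _    | yes w≡p | _      = ⊥-elim (w≢p w≡p)
    ... | no _    | no _    | yes h  = inj₁ (h , refl)
    ... | no _    | no _    | no ¬h  = inj₂ (¬h , refl)

    module _ (ᴬ : IsElimTreeᴬ t) (v→p : parent t v ≡ just p) where
      open IsElimTreeᴬ ᴬ

      v≢p : ¬ v ≡ p
      v≢p refl = parent≢self acyclic v→p

      rotateAt-rotated : Rotated t (rotateAt t v p) v p
      rotateAt-rotated = record
        { v≢p        = v≢p
        ; v→p        = v→p
        ; p→v        = parent-rotateAt-p (v≢p ∘ sym)
        ; v-inherits = parent-rotateAt-v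
        ; others     = others
        }
        where
          others : ∀ w → ¬ w ≡ v → ¬ w ≡ p → parent (rotateAt t v p) w ≡ parent t w
                   ⊎ (parent t w ≡ just v × parent (rotateAt t v p) w ≡ just p)
          others w w≢v w≢p with parent-rotateAt-other w w≢v w≢p
          ... | inj₁ ((wv , _) , moved) = inj₂ (wv , moved)
          ... | inj₂ (_ , same)         = inj₁ same

      rotateAt-handover : ∀ {c} → parent t c ≡ just v → parent (rotateAt t v p) c ≡ just p ⇔ SubtreeAdjacent t p c
      rotateAt-handover {c} cv with parent-chain-distinct acyclic cv v→p
      ... | c≢v , c≢p = mk⇔ to from
        where
          to : parent (rotateAt t v p) c ≡ just p → SubtreeAdjacent t p c
          to moved with parent-rotateAt-other c c≢v c≢p
          ... | inj₁ ((_ , z , cz , e) , _) = z , withinN⇒ancestor cz , e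
          ... | inj₂ (_ , same)             = ⊥-elim (v≢p (just-injective (trans (sym cv) (trans (sym same) moved))))
          from : SubtreeAdjacent t p c → parent (rotateAt t v p) c ≡ just p
          from (z , cz , e) with parent-rotateAt-other c c≢v c≢p
          ... | inj₁ (_ , moved) = moved
          ... | inj₂ (¬h , _)    = ⊥-elim (¬h (cv , z , ancestor⇒withinN acyclic cz , e))

      rotateAt-isElimTreeᴬ : IsElimTreeᴬ (rotateAt t v p)
      rotateAt-isElimTreeᴬ = Preservation.isElimTreeᴬ₂ rotateAt-rotated ᴬ rotateAt-handover

  -- Rotating back is again a rotation at the same edge, and it returns each child of p to its old parent:
  -- a sibling of v has no neighbour of v below it, while a handed-over child of v does.
  rotateAt-involutive : ∀ {t v p} → IsElimTreeᴬ t → parent t v ≡ just p → rotateAt (rotateAt t v p) p v ≡ t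
  rotateAt-involutive {t} {v} {p} ᴬ v→p = rotated-unique R₃ (rotated-sym R) children
    where
      open IsElimTreeᴬ ᴬ

      R : Rotated t (rotateAt t v p) v p
      R = rotateAt-rotated ᴬ v→p

      ᴬ₂ : IsElimTreeᴬ (rotateAt t v p)
      ᴬ₂ = rotateAt-isElimTreeᴬ ᴬ v→p

      p→v : parent (rotateAt t v p) p ≡ just v
      p→v = Rotated.p→v R

      R₃ : Rotated (rotateAt t v p) (rotateAt (rotateAt t v p) p v) p v
      R₃ = rotateAt-rotated ᴬ₂ p→v

      children : ∀ {c} → parent (rotateAt t v p) c ≡ just p → parent (rotateAt (rotateAt t v p) p v) c ≡ parent t c
      children {c} cp₂ with c≢p , c≢v ← parent-chain-distinct (IsElimTreeᴬ.acyclic ᴬ₂) cp₂ p→v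
        with Rotated.others R c c≢v c≢p
      ... | inj₂ (cv , _) with w , cw , e ← subtree-adjacent c v cv =
        trans (Equivalence.from (rotateAt-handover ᴬ₂ p→v cp₂) (w , Transfer.ancestor-preserved R c≢v c≢p cw , e))
              (sym cv)
      ... | inj₁ same with Rotated.others R₃ c c≢p c≢v
      ...   | inj₁ same₃        = trans same₃ same
      ...   | inj₂ (_ , cv₃) with w , cw₂ , e ← Equivalence.to (rotateAt-handover ᴬ₂ p→v cp₂) cv₃ =
        ⊥-elim (sibling-subtree-not-adjacent ᴬ v→p (trans (sym same) cp₂) (c≢v ∘ sym)
                  (w , Transfer.ancestor-preserved (rotated-sym R) c≢p c≢v cw₂ , e))

  -- Only applied to non-roots v; on a root it is the identity.
  rotate : Tree n × Fin n → Tree n × Fin n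
  rotate (t , v) with parent t v
  ... | nothing = t , v
  ... | just p  = rotateAt t v p , p

  rotate-just : ∀ {t v p} → parent t v ≡ just p → rotate (t , v) ≡ (rotateAt t v p , p)
  rotate-just e rewrite e = refl

module Enumeration {n : ℕ} (G : Graph n) where
  open Ancestry
  open Characterisation G
  open Rotation G

  allParents : List (Maybe (Fin n))
  allParents = nothing ∷ map just (allFin n)

  allParents⁺ : Unique allParents
  allParents⁺ = All.tabulate nothing∉ ∷ map⁺ just-injective (allFin⁺ n)
    where nothing∉ : ∀ {m} → m ∈ map just (allFin n) → ¬ nothing ≡ m
          nothing∉ m∈ refl with () ← ∈-map⁻ just m∈

  ∈-allParents : ∀ m → m ∈ allParents
  ∈-allParents nothing  = here refl
  ∈-allParents (just v) = there (∈-map⁺ just (∈-allFin v))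

  allTrees : List (Tree n)
  allTrees = allVecs allParents⁺ ∈-allParents n

  elimTrees : List (Tree n)
  elimTrees = filter isElimTreeᴬ? allTrees

  elimTrees⁺ : Unique elimTrees
  elimTrees⁺ = filter⁺ isElimTreeᴬ? (allVecs⁺ allParents⁺ ∈-allParents n)

  ∈-elimTrees : ∀ {t} → t ∈ elimTrees ⇔ IsElimTreeᴬ t
  ∈-elimTrees {t} = mk⇔ (proj₂ ∘ ∈-filter⁻ isElimTreeᴬ? {xs = allTrees})
                        (∈-filter⁺ isElimTreeᴬ? (∈-allVecs allParents⁺ ∈-allParents t))

  isRoot? : ∀ (t : Tree n) v → Dec (parent t v ≡ nothing)
  isRoot? t v = ≡-decᴹ _≟_ (parent t v) nothing

  nonRoot? : ∀ (t : Tree n) v → Dec (¬ parent t v ≡ nothing)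
  nonRoot? t v = ¬? (isRoot? t v)

  nonRoots : Tree n → List (Fin n)
  nonRoots t = filter (nonRoot? t) (allFin n)

  nonRoot⇒parent : ∀ {t v} → v ∈ nonRoots t → Σ (Fin n) λ p → parent t v ≡ just p
  nonRoot⇒parent {t} {v} v∈ with parent t v in pv
  ... | nothing = ⊥-elim (proj₂ (∈-filter⁻ (nonRoot? t) {xs = allFin n} v∈) pv)
  ... | just p  = p , refl

  length-nonRoots : ∀ {t} → IsElimTreeᴬ t → n ≡ suc (length (nonRoots t))
  length-nonRoots {t} ᴬ = let x , px , only-root = IsElimTreeᴬ.root ᴬ in
    trans (sym (length-tabulate {n = n} (λ v → v)))
          (length-filter-¬-unique (isRoot? t) (allFin⁺ n) (∈-allFin x) px (λ _ → only-root _))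

  -- A pair (t , v) with v a non-root of t stands for the edge of t from v up to its parent.
  edges : List (Tree n × Fin n)
  edges = pairs nonRoots elimTrees

  length-edges : length edges + length elimTrees ≡ length elimTrees * n
  length-edges = length-pairs nonRoots elimTrees (sym ∘ length-nonRoots ∘ Equivalence.to ∈-elimTrees)

  _≟ᵉ_ : DecidableEquality (Tree n × Fin n)
  _≟ᵉ_ = ≡-decˣ (≡-decⱽ (≡-decᴹ _≟_)) _≟_

  ∈-edges⁻ : ∀ {t v} → (t , v) ∈ edges → IsElimTreeᴬ t × Σ (Fin n) λ p → parent t v ≡ just p
  ∈-edges⁻ {t} e∈ with t∈ , v∈ ← ∈-pairs⁻ nonRoots e∈ = Equivalence.to ∈-elimTrees t∈ , nonRoot⇒parent {t} v∈

  rotate-edges : ∀ {e} → e ∈ edges → rotate e ∈ edges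
  rotate-edges {t , v} e∈ with ᴬ , p , v→p ← ∈-edges⁻ e∈ = subst (_∈ edges) (sym (rotate-just v→p))
    (∈-pairs⁺ nonRoots (Equivalence.from ∈-elimTrees (rotateAt-isElimTreeᴬ ᴬ v→p))
                       (∈-filter⁺ (nonRoot? (rotateAt t v p)) (∈-allFin p) p-nonRoot))
    where
      p-nonRoot : ¬ parent (rotateAt t v p) p ≡ nothing
      p-nonRoot p-root = case trans (sym (Rotated.p→v (rotateAt-rotated ᴬ v→p))) p-root of λ ()

  rotate-involutive : ∀ {e} → e ∈ edges → rotate (rotate e) ≡ e
  rotate-involutive {t , v} e∈ with ᴬ , p , v→p ← ∈-edges⁻ e∈ = begin
    rotate (rotate (t , v))              ≡⟨ cong rotate (rotate-just v→p) ⟩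
    rotate (rotateAt t v p , p)          ≡⟨ rotate-just (Rotated.p→v (rotateAt-rotated ᴬ v→p)) ⟩
    (rotateAt (rotateAt t v p) p v , v)  ≡⟨ cong (_, v) (rotateAt-involutive ᴬ v→p) ⟩
    (t , v)                              ∎
    where open ≡-Reasoning

  rotate-fixpoint-free : ∀ {e} → e ∈ edges → ¬ rotate e ≡ e
  rotate-fixpoint-free {t , v} e∈ fixed with ᴬ , p , v→p ← ∈-edges⁻ e∈ =
    v≢p ᴬ v→p (sym (cong proj₂ (trans (sym (rotate-just v→p)) fixed)))

  edges-paired : PairedBy rotate edges
  edges-paired = record
    { unique        = pairs⁺ nonRoots elimTrees⁺ (λ t → filter⁺ (nonRoot? t) (allFin⁺ n))
    ; closed        = rotate-edges
    ; involutive    = rotate-involutive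
    ; fixpoint-free = rotate-fixpoint-free
    }

lemma29 : (n : ℕ) → 2 ∣ n → (G : Graph n) → Connected G →
    Σ (List (Tree n)) λ ts →
      Unique ts × (∀ t → IsElimTree G t ⇔ t ∈ ts) × 2 ∣ length ts
lemma29 n 2∣n G connected = elimTrees , elimTrees⁺ , characterisation , elimTrees-even
  where
    open Enumeration G
    open Characterisation G

    characterisation : ∀ t → IsElimTree G t ⇔ t ∈ elimTrees
    characterisation t = mk⇔ (Equivalence.from ∈-elimTrees ∘ isElimTree⇒ᴬ connected)
                             (ᴬ⇒isElimTree ∘ Equivalence.to ∈-elimTrees)

    -- Counting the pairs (t , v) for all v, roots included, gives length elimTrees * n.
    elimTrees-even : 2 ∣ length elimTrees
    elimTrees-even = ∣m+n∣m⇒∣n (subst (2 ∣_) (sym length-edges) (∣n⇒∣m*n (length elimTrees) 2∣n))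
                                (paired⇒even-length _≟ᵉ_ edges-paired)
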